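{- Let $\ell\in\{1,2,3\}$, let $G$ be a $(2,\ell)$-tight simple graph, and let $G'$ be obtained from $G$ by the $K_3$-to-edge move on a copy $K_3(a,b,c)$ of $K_3$ in which the vertices $a,b$ are merged. Then $G'$ is simple unless there is a copy $K_3(a,b,d)$ of $K_3$ in $G$ with $d\neq c$; and $G'$ is $(2,\ell)$-sparse unless there is a $(2,\ell)$-tight subgraph $Y\subseteq G$ with $ab\in E(Y)$ and $c\notin V(Y)$.
   Context: For a graph $H$ let $f(H)=2|V(H)|-|E(H)|$. A simple graph $G$ is $(2,\ell)$-sparse if $f(H)\ge \ell$ for every subgraph $H$ of $G$ with at least one edge, and $(2,\ell)$-tight if it is $(2,\ell)$-sparse and $f(G)=\ell$. $K_3(a,b,c)$ denotes a subgraph of $G$ which is a triangle on vertices $a,b,c$. The $K_3$-to-edge move on $K_3(c,a,b)$ merging $a,b$: delete the edges $ca,cb,ab$, identify $a$ and $b$ into a single new vertex $v$ adjacent to all vertices previously adjacent to $a$ or $b$ (other than via the deleted edges), and add the edge $cv$. -}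

module Defs where

open import Data.Nat using (ℕ; zero; suc; _+_; _*_; _≤_)
open import Data.Fin using (Fin; _<?_)
import Data.Fin as F
open import Data.Fin.Subset using (Subset; _∈_; _∉_; _⊆_; ∣_∣; _-_)
open import Data.Integer as ℤ using (ℤ; +_)
open import Data.Product using (_×_; Σ; ∃; ∃-syntax)
open import Relation.Binary.PropositionalEquality using (_≡_; _≢_)
open import Relation.Nullary using (¬_; yes; no)

sumFin : {n : ℕ} → (Fin n → ℕ) → ℕ
sumFin {zero}  f = 0
sumFin {suc n} f = f F.zero + sumFin (λ i → f (F.suc i))

-- A (multi)graph with vertex set a subset V of the ambient set Fin n;
-- mult i j = number of edges between i and j.
record Graph (n : ℕ) : Set where
  constructor graph
  field
    V    : Subset n
    mult : Fin n → Fin n → ℕ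
open Graph public

record IsGraph {n : ℕ} (G : Graph n) : Set where
  field
    sym      : ∀ i j → mult G i j ≡ mult G j i
    loopless : ∀ i → mult G i i ≡ 0
    support  : ∀ i j → 1 ≤ mult G i j → (i ∈ V G) × (j ∈ V G)
open IsGraph public

Simple : {n : ℕ} → Graph n → Set
Simple G = (∀ i → mult G i i ≡ 0) × (∀ i j → mult G i j ≤ 1)

numEdges : {n : ℕ} → Graph n → ℕ
numEdges G = sumFin (λ i → sumFin (λ j → lt i j))
  where
  lt : _ → _ → ℕ
  lt i j with i <? j
  ... | yes _ = mult G i j
  ... | no  _ = 0

f : {n : ℕ} → Graph n → ℤ
f H = + (2 * ∣ V H ∣) ℤ.- + numEdges H

_≤G_ : {n : ℕ} → Graph n → Graph n → Set
H ≤G G = IsGraph H × (V H ⊆ V G) × (∀ i j → mult H i j ≤ mult G i j)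

Sparse : {n : ℕ} → ℕ → Graph n → Set
Sparse ℓ G = ∀ H → H ≤G G → 1 ≤ numEdges H → + ℓ ℤ.≤ f H

Tight : {n : ℕ} → ℕ → Graph n → Set
Tight ℓ G = Sparse ℓ G × (f G ≡ + ℓ)

K3 : {n : ℕ} → Graph n → Fin n → Fin n → Fin n → Set
K3 G a b c = (a ≢ b) × (b ≢ c) × (a ≢ c)
           × (1 ≤ mult G a b) × (1 ≤ mult G b c) × (1 ≤ mult G a c)

[_≟_] : {n : ℕ} → Fin n → Fin n → ℕ
[ x ≟ y ] with x F.≟ y
... | yes _ = 1
... | no  _ = 0

delTri : {n : ℕ} → Graph n → Fin n → Fin n → Fin n → Graph n
delTri {n} G a b c = graph (V G) m
  where
  isTri : Fin n → Fin n → ℕ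
  isTri u w with (u F.≟ a) | (u F.≟ b) | (u F.≟ c) | (w F.≟ a) | (w F.≟ b) | (w F.≟ c)
  ... | yes _ | _ | _ | _ | yes _ | _ = 1
  ... | yes _ | _ | _ | _ | _ | yes _ = 1
  ... | _ | yes _ | _ | yes _ | _ | _ = 1
  ... | _ | yes _ | _ | _ | _ | yes _ = 1
  ... | _ | _ | yes _ | yes _ | _ | _ = 1
  ... | _ | _ | yes _ | _ | yes _ | _ = 1
  ... | _ | _ | _ | _ | _ | _ = 0
  m : Fin n → Fin n → ℕ
  m u w with isTri u w
  ... | 1 = 0
  ... | _ = mult G u w

-- The K₃-to-edge move on K₃(c,a,b) merging a and b: the merged vertex is
-- represented by a, and b is removed from the vertex set.  The
-- multiplicity between x and y in the new graph is the number of
-- remaining edges uw of G with φ u = x, φ w = y (φ b = a, φ = id else),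
-- plus one new edge ca.
k3ToEdge : {n : ℕ} → Graph n → Fin n → Fin n → Fin n → Graph n
k3ToEdge {n} G a b c = graph (V G - b) m'
  where
  G0 = delTri G a b c
  φ : Fin n → Fin n
  φ u with u F.≟ b
  ... | yes _ = a
  ... | no  _ = u
  m' : Fin n → Fin n → ℕ
  m' x y with x F.≟ b | y F.≟ b
  ... | yes _ | _ = 0
  ... | no _ | yes _ = 0
  ... | no _ | no _ =
        sumFin (λ u → sumFin (λ w → [ φ u ≟ x ] * [ φ w ≟ y ] * mult G0 u w))
        + [ x ≟ c ] * [ y ≟ a ] + [ x ≟ a ] * [ y ≟ c ]

-- For sparsity, a subgraph H' of G' containing a is
-- lifted to H ⊆ G with one more vertex (b) and at least 1 + t more edges,
-- where t = 1 if c ∈ H' and t = 0 otherwise (`Unmerge`).  Then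
-- f(H') ≥ f(H) ≥ ℓ if c ∈ H', while if c ∉ H' and f(H') < ℓ the lift H is
-- a tight subgraph containing ab but not c (`Sparsity`).  The argument
-- works for every ℓ.
module Submission where

open import Defs hiding (sym)
open import Data.Nat using (ℕ; zero; suc; _+_; _*_; _∸_; _≤_; _⊓_; z≤n; s≤s; _≤?_)
open import Data.Nat.Properties hiding (_≟_)
open import Data.Nat.Tactic.RingSolver using (solve-∀)
open import Data.Fin using (Fin)
import Data.Fin as F
import Data.Fin.Properties as FP
open import Data.Fin.Subset using (Subset; _∈_; _∉_; _⊆_; ∣_∣; _-_; _─_; _∪_; ⁅_⁆; inside; outside)
open import Data.Fin.Subset.Properties using (_∈?_; x∈⁅x⁆; x∈⁅y⁆⇒x≡y; p─q⊆p; x∈p∪q⁺; x∈p∪q⁻; ∪-identityʳ)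
open import Data.Vec using (_∷_; here; there)
open import Data.Product using (_×_; _,_; proj₁; proj₂; ∃; ∃-syntax)
open import Data.Sum using (_⊎_; inj₁; inj₂)
open import Data.Empty using (⊥-elim)
open import Function using (_∘_)
open import Relation.Binary.PropositionalEquality hiding ([_])
open import Relation.Binary.Definitions using (tri<; tri≈; tri>)
open import Relation.Nullary using (¬_; Dec; yes; no)
open import Algebra.Properties.Semiring.Sum +-*-semiring
  using (sum; sum-cong-≗; ∑-distrib-+; ∑-comm; *-distribˡ-sum)

sumFin≡sum : ∀ {n} (h : Fin n → ℕ) → sumFin h ≡ sum h
sumFin≡sum {zero}  h = refl
sumFin≡sum {suc n} h = cong (h F.zero +_) (sumFin≡sum (λ i → h (F.suc i)))

sumFin-cong : ∀ {n} {g h : Fin n → ℕ} → (∀ i → g i ≡ h i) → sumFin g ≡ sumFin h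
sumFin-cong {zero}  e = refl
sumFin-cong {suc n} e = cong₂ _+_ (e F.zero) (sumFin-cong (λ i → e (F.suc i)))

sumFin-mono : ∀ {n} {g h : Fin n → ℕ} → (∀ i → g i ≤ h i) → sumFin g ≤ sumFin h
sumFin-mono {zero}  le = z≤n
sumFin-mono {suc n} le = +-mono-≤ (le F.zero) (sumFin-mono (λ i → le (F.suc i)))

sumFin-zero : ∀ {n} → sumFin {n} (λ _ → 0) ≡ 0
sumFin-zero {zero}  = refl
sumFin-zero {suc n} = sumFin-zero {n}

sumFin-+ : ∀ {n} (g h : Fin n → ℕ) → sumFin (λ i → g i + h i) ≡ sumFin g + sumFin h
sumFin-+ g h = begin
  sumFin (λ i → g i + h i)  ≡⟨ sumFin≡sum (λ i → g i + h i) ⟩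
  sum (λ i → g i + h i)     ≡⟨ ∑-distrib-+ g h ⟩
  sum g + sum h             ≡⟨ cong₂ _+_ (sumFin≡sum g) (sumFin≡sum h) ⟨
  sumFin g + sumFin h       ∎
  where open ≡-Reasoning

sumFin-*ˡ : ∀ {n} (k : ℕ) (h : Fin n → ℕ) → sumFin (λ i → k * h i) ≡ k * sumFin h
sumFin-*ˡ k h = begin
  sumFin (λ i → k * h i)  ≡⟨ sumFin≡sum (λ i → k * h i) ⟩
  sum (λ i → k * h i)     ≡⟨ *-distribˡ-sum k h ⟨
  k * sum h               ≡⟨ cong (k *_) (sumFin≡sum h) ⟨
  k * sumFin h            ∎
  where open ≡-Reasoning

Σ² : ∀ {n} → (Fin n → Fin n → ℕ) → ℕ
Σ² h = sumFin (λ i → sumFin (h i))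

Σ²-cong : ∀ {n} {g h : Fin n → Fin n → ℕ} → (∀ i j → g i j ≡ h i j) → Σ² g ≡ Σ² h
Σ²-cong e = sumFin-cong (λ i → sumFin-cong (e i))

Σ²-mono : ∀ {n} {g h : Fin n → Fin n → ℕ} → (∀ i j → g i j ≤ h i j) → Σ² g ≤ Σ² h
Σ²-mono le = sumFin-mono (λ i → sumFin-mono (le i))

Σ²-+ : ∀ {n} (g h : Fin n → Fin n → ℕ) → Σ² (λ i j → g i j + h i j) ≡ Σ² g + Σ² h
Σ²-+ g h = trans (sumFin-cong (λ i → sumFin-+ (g i) (h i)))
                 (sumFin-+ (λ i → sumFin (g i)) (λ i → sumFin (h i)))

Σ²-*ˡ : ∀ {n} (k : ℕ) (h : Fin n → Fin n → ℕ) → Σ² (λ i j → k * h i j) ≡ k * Σ² h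
Σ²-*ˡ k h = trans (sumFin-cong (λ i → sumFin-*ˡ k (h i))) (sumFin-*ˡ k (λ i → sumFin (h i)))

sumFin-swap : ∀ {m n} (h : Fin m → Fin n → ℕ) →
  sumFin (λ i → sumFin (h i)) ≡ sumFin (λ j → sumFin (λ i → h i j))
sumFin-swap h = begin
  sumFin (λ i → sumFin (h i))          ≡⟨ sumFin≡sum (λ i → sumFin (h i)) ⟩
  sum (λ i → sumFin (h i))             ≡⟨ sum-cong-≗ (λ i → sumFin≡sum (h i)) ⟩
  sum (λ i → sum (h i))                ≡⟨ ∑-comm h ⟩
  sum (λ j → sum (λ i → h i j))        ≡⟨ sum-cong-≗ (λ j → sumFin≡sum (λ i → h i j)) ⟨
  sum (λ j → sumFin (λ i → h i j))     ≡⟨ sumFin≡sum (λ j → sumFin (λ i → h i j)) ⟨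
  sumFin (λ j → sumFin (λ i → h i j))  ∎
  where open ≡-Reasoning

ind-yes : ∀ {n} {x y : Fin n} → x ≡ y → [ x ≟ y ] ≡ 1
ind-yes {x = x} {y} x≡y with x F.≟ y
... | yes _   = refl
... | no x≢y = ⊥-elim (x≢y x≡y)

ind-no : ∀ {n} {x y : Fin n} → x ≢ y → [ x ≟ y ] ≡ 0
ind-no {x = x} {y} x≢y with x F.≟ y
... | yes x≡y = ⊥-elim (x≢y x≡y)
... | no _    = refl

ind-refl : ∀ {n} (x : Fin n) → [ x ≟ x ] ≡ 1
ind-refl x = ind-yes refl

ind-sym : ∀ {n} (x y : Fin n) → [ x ≟ y ] ≡ [ y ≟ x ]
ind-sym x y with x F.≟ y
... | yes x≡y = sym (ind-yes (sym x≡y))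
... | no x≢y  = sym (ind-no (x≢y ∘ sym))

sumFin-single : ∀ {n} (k : Fin n) (h : Fin n → ℕ) → (∀ i → i ≢ k → h i ≡ 0) → sumFin h ≡ h k
sumFin-single {suc n} F.zero h vanish = begin
  h F.zero + sumFin (λ i → h (F.suc i))  ≡⟨ cong (h F.zero +_) (sumFin-cong (λ i → vanish (F.suc i) (λ ()))) ⟩
  h F.zero + sumFin {n} (λ _ → 0)        ≡⟨ cong (h F.zero +_) (sumFin-zero {n}) ⟩
  h F.zero + 0                           ≡⟨ +-identityʳ (h F.zero) ⟩
  h F.zero                               ∎
  where open ≡-Reasoning
sumFin-single (F.suc k) h vanish = begin
  h F.zero + sumFin (λ i → h (F.suc i))  ≡⟨ cong (_+ sumFin (λ i → h (F.suc i))) (vanish F.zero (λ ())) ⟩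
  sumFin (λ i → h (F.suc i))             ≡⟨ sumFin-single k (λ i → h (F.suc i)) vanish-tail ⟩
  h (F.suc k)                            ∎
  where
  open ≡-Reasoning
  vanish-tail : ∀ i → i ≢ k → h (F.suc i) ≡ 0
  vanish-tail i i≢k = vanish (F.suc i) (i≢k ∘ FP.suc-injective)

sift : ∀ {n} (k : Fin n) (h : Fin n → ℕ) → sumFin (λ i → [ i ≟ k ] * h i) ≡ h k
sift k h = trans (sumFin-single k (λ i → [ i ≟ k ] * h i) (λ i i≢k → cong (_* h i) (ind-no i≢k)))
                 (trans (cong (_* h k) (ind-refl k)) (+-identityʳ (h k)))

sift' : ∀ {n} (k : Fin n) (h : Fin n → ℕ) → sumFin (λ i → [ k ≟ i ] * h i) ≡ h k
sift' k h = trans (sumFin-cong (λ i → cong (_* h i) (ind-sym k i))) (sift k h)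

positive-+ : ∀ m n → 1 ≤ m + n → 1 ≤ m ⊎ 1 ≤ n
positive-+ zero    n pos = inj₂ pos
positive-+ (suc m) n _   = inj₁ (s≤s z≤n)

pairInd : ∀ {n} → Fin n → Fin n → Fin n → Fin n → ℕ
pairInd p q u w = [ u ≟ p ] * [ w ≟ q ]

pairInd-pos : ∀ {n} {p q u w : Fin n} → 1 ≤ pairInd p q u w → u ≡ p × w ≡ q
pairInd-pos {p = p} {q} {u} {w} pos with u F.≟ p | w F.≟ q
... | yes u≡p | yes w≡q = u≡p , w≡q
... | yes _   | no _    = ⊥-elim (1+n≰n pos)
... | no _    | _       = ⊥-elim (1+n≰n pos)

Σ²-pairInd : ∀ {n} (p q : Fin n) → Σ² (pairInd p q) ≡ 1
Σ²-pairInd p q = begin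
  sumFin (λ u → sumFin (λ w → [ u ≟ p ] * [ w ≟ q ]))  ≡⟨ sumFin-cong inner ⟩
  sumFin (λ u → [ u ≟ p ] * 1)                        ≡⟨ sift p (λ _ → 1) ⟩
  1                                                   ∎
  where
  open ≡-Reasoning
  inner : ∀ u → sumFin (λ w → [ u ≟ p ] * [ w ≟ q ]) ≡ [ u ≟ p ] * 1
  inner u = begin
    sumFin (λ w → [ u ≟ p ] * [ w ≟ q ])  ≡⟨ sumFin-cong (λ w → *-comm [ u ≟ p ] [ w ≟ q ]) ⟩
    sumFin (λ w → [ w ≟ q ] * [ u ≟ p ])  ≡⟨ sift q (λ _ → [ u ≟ p ]) ⟩
    [ u ≟ p ]                             ≡⟨ *-identityʳ [ u ≟ p ] ⟨
    [ u ≟ p ] * 1                         ∎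

edge : ∀ {n} → Fin n → Fin n → Fin n → Fin n → ℕ
edge p q u w = pairInd p q u w + pairInd q p u w

edge-sym : ∀ {n} (p q u w : Fin n) → edge p q u w ≡ edge p q w u
edge-sym p q u w = trans (+-comm (pairInd p q u w) (pairInd q p u w))
  (cong₂ _+_ (*-comm [ u ≟ q ] [ w ≟ p ]) (*-comm [ u ≟ p ] [ w ≟ q ]))

Edge : ∀ {n} → Fin n → Fin n → Fin n → Fin n → Set
Edge p q u w = (u ≡ p × w ≡ q) ⊎ (u ≡ q × w ≡ p)

edge-pos : ∀ {n} {p q u w : Fin n} → 1 ≤ edge p q u w → Edge p q u w
edge-pos {p = p} {q} {u} {w} pos with positive-+ (pairInd p q u w) (pairInd q p u w) pos
... | inj₁ pq = inj₁ (pairInd-pos pq)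
... | inj₂ qp = inj₂ (pairInd-pos qp)

edge-at : ∀ {n} (p q : Fin n) → 1 ≤ edge p q p q
edge-at p q = ≤-trans (≤-reflexive (sym (cong₂ _*_ (ind-refl p) (ind-refl q))))
                      (m≤m+n (pairInd p q p q) (pairInd q p p q))

Σ²-edge : ∀ {n} (p q : Fin n) → Σ² (edge p q) ≡ 2
Σ²-edge p q = trans (Σ²-+ (pairInd p q) (pairInd q p)) (cong₂ _+_ (Σ²-pairInd p q) (Σ²-pairInd q p))

upper : ∀ {n} → (Fin n → Fin n → ℕ) → Fin n → Fin n → ℕ
upper g i j with i F.<? j
... | yes _ = g i j
... | no  _ = 0

-- The summand of `numEdges` is local to its definition, so the type of
-- this pointwise agreement is left to be inferred from its use below.
summand≡upper : ∀ {n} (G : Graph n) (i j : Fin n) → _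
numEdges≡Σ²upper : ∀ {n} (G : Graph n) → numEdges G ≡ Σ² (upper (mult G))
numEdges≡Σ²upper G = Σ²-cong (summand≡upper G)
summand≡upper G i j with i F.<? j
... | yes _ = refl
... | no  _ = refl

upper+lower : ∀ {n} (g : Fin n → Fin n → ℕ) → (∀ i j → g i j ≡ g j i) → (∀ i → g i i ≡ 0) →
  ∀ i j → g i j ≡ upper g i j + upper g j i
upper+lower g sym-g loop-g i j with i F.<? j | j F.<? i
... | yes i<j | yes j<i = ⊥-elim (FP.<-asym i<j j<i)
... | yes _   | no _    = sym (+-identityʳ (g i j))
... | no _    | yes _   = sym-g i j
... | no i≮j  | no j≮i with FP.<-cmp i j
...   | tri< i<j _ _ = ⊥-elim (i≮j i<j)
...   | tri> _ _ j<i = ⊥-elim (j≮i j<i)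
...   | tri≈ _ refl _ = loop-g i

handshake : ∀ {n} (G : Graph n) → (∀ i j → mult G i j ≡ mult G j i) → (∀ i → mult G i i ≡ 0) →
  Σ² (mult G) ≡ numEdges G + numEdges G
handshake {n} G sym-G loop-G = begin
  Σ² (mult G)                                ≡⟨ Σ²-cong (upper+lower (mult G) sym-G loop-G) ⟩
  Σ² (λ i j → up i j + up j i)               ≡⟨ Σ²-+ up (λ i j → up j i) ⟩
  Σ² up + Σ² (λ i j → up j i)                ≡⟨ cong (Σ² up +_) (sumFin-swap (λ i j → up j i)) ⟩
  Σ² up + Σ² up                              ≡⟨ cong₂ _+_ (numEdges≡Σ²upper G) (numEdges≡Σ²upper G) ⟨
  numEdges G + numEdges G                    ∎
  where
  open ≡-Reasoning
  up : Fin n → Fin n → ℕ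
  up = upper (mult G)

module IntegerBounds where
  open import Data.Integer as ℤ using (+_)
  import Data.Integer.Properties as ℤP

  ≤-minus⇒ : ∀ ℓ v e → + ℓ ℤ.≤ + v ℤ.- + e → ℓ + e ≤ v
  ≤-minus⇒ ℓ v e ℓ≤v-e = ℤP.drop‿+≤+ (begin
    + ℓ ℤ.+ + e                ≤⟨ ℤP.+-monoˡ-≤ (+ e) ℓ≤v-e ⟩
    + v ℤ.- + e ℤ.+ + e        ≡⟨ ℤP.+-assoc (+ v) (ℤ.- + e) (+ e) ⟩
    + v ℤ.+ (ℤ.- + e ℤ.+ + e)  ≡⟨ cong (λ z → + v ℤ.+ z) (ℤP.+-inverseˡ (+ e)) ⟩
    + v ℤ.+ + 0                ≡⟨ ℤP.+-identityʳ (+ v) ⟩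
    + v                        ∎)
    where open ℤP.≤-Reasoning

  ⇒≤-minus : ∀ ℓ v e → ℓ + e ≤ v → + ℓ ℤ.≤ + v ℤ.- + e
  ⇒≤-minus ℓ v e ℓ+e≤v = begin
    + ℓ                        ≡⟨ ℤP.+-identityʳ (+ ℓ) ⟨
    + ℓ ℤ.+ + 0                ≡⟨ cong (λ z → + ℓ ℤ.+ z) (ℤP.+-inverseʳ (+ e)) ⟨
    + ℓ ℤ.+ (+ e ℤ.- + e)      ≡⟨ ℤP.+-assoc (+ ℓ) (+ e) (ℤ.- + e) ⟨
    + (ℓ + e) ℤ.- + e          ≤⟨ ℤP.+-monoˡ-≤ (ℤ.- + e) (ℤ.+≤+ ℓ+e≤v) ⟩
    + v ℤ.- + e                ∎
    where open ℤP.≤-Reasoning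

  ≡-minus : ∀ ℓ v e → ℓ + e ≡ v → + v ℤ.- + e ≡ + ℓ
  ≡-minus ℓ v e refl = begin
    + (ℓ + e) ℤ.- + e          ≡⟨ ℤP.+-assoc (+ ℓ) (+ e) (ℤ.- + e) ⟩
    + ℓ ℤ.+ (+ e ℤ.- + e)      ≡⟨ cong (λ z → + ℓ ℤ.+ z) (ℤP.+-inverseʳ (+ e)) ⟩
    + ℓ ℤ.+ + 0                ≡⟨ ℤP.+-identityʳ (+ ℓ) ⟩
    + ℓ                        ∎
    where open ≡-Reasoning

open IntegerBounds

∉q-of-p─q : ∀ {n} (p q : Subset n) {x} → x ∈ p ─ q → x ∉ q
∉q-of-p─q (_ ∷ p) (_ ∷ q)      (there x∈p─q) (there x∈q) = ∉q-of-p─q p q x∈p─q x∈q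
∉q-of-p─q (_ ∷ p) (inside ∷ q) ()            here

∉-of-⊆-removed : ∀ {n} {p q : Subset n} {x} → q ⊆ p - x → x ∉ q
∉-of-⊆-removed {p = p} {x = x} q⊆p-x x∈q = ∉q-of-p─q p ⁅ x ⁆ (q⊆p-x x∈q) (x∈⁅x⁆ x)

∣p∪⁅x⁆∣≤ : ∀ {n} (p : Subset n) (x : Fin n) → ∣ p ∪ ⁅ x ⁆ ∣ ≤ suc ∣ p ∣
∣p∪⁅x⁆∣≤ (inside  ∷ p) F.zero    = s≤s (≤-trans (≤-reflexive (cong ∣_∣ (∪-identityʳ p))) (n≤1+n ∣ p ∣))
∣p∪⁅x⁆∣≤ (outside ∷ p) F.zero    = s≤s (≤-reflexive (cong ∣_∣ (∪-identityʳ p)))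
∣p∪⁅x⁆∣≤ (inside  ∷ p) (F.suc x) = s≤s (∣p∪⁅x⁆∣≤ p x)
∣p∪⁅x⁆∣≤ (outside ∷ p) (F.suc x) = ∣p∪⁅x⁆∣≤ p x

positive-* : ∀ m n → 1 ≤ m * n → 1 ≤ m × 1 ≤ n
positive-* (suc m) (suc n) _   = s≤s z≤n , s≤s z≤n
positive-* (suc m) zero    pos = ⊥-elim (1+n≰n (≤-trans pos (≤-reflexive (*-zeroʳ (suc m)))))

-- p items fit into bins of capacities q and s: fill the first bin, then
-- put the overflow p ∸ q into the second.
fill-two-bins : ∀ p q s → p ≤ q + s → p ≤ p ⊓ q + (p ∸ q) ⊓ s
fill-two-bins p q s p≤q+s with q ≤? p
... | yes q≤p rewrite m≥n⇒m⊓n≡n q≤p | m≤n⇒m⊓n≡m (≤-trans (∸-monoˡ-≤ q p≤q+s) (≤-reflexive (m+n∸m≡n q s))) =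
  ≤-reflexive (sym (m+[n∸m]≡n q≤p))
... | no q≰p rewrite m≤n⇒m⊓n≡m (<⇒≤ (≰⇒> q≰p)) = m≤m+n p ((p ∸ q) ⊓ s)

halve : ∀ p q → p + p ≤ q + q → p ≤ q
halve p q 2p≤2q with p ≤? q
... | yes p≤q = p≤q
... | no p≰q  = ⊥-elim (<⇒≱ (+-mono-< (≰⇒> p≰q) (≰⇒> p≰q)) 2p≤2q)

no-edges-outside : ∀ {n} {H : Graph n} → IsGraph H → ∀ {i} j → i ∉ V H → mult H i j ≡ 0
no-edges-outside {H = H} H-graph {i} j i∉H with mult H i j in eq
... | zero  = refl
... | suc _ = ⊥-elim (i∉H (proj₁ (IsGraph.support H-graph i j (≤-trans (s≤s z≤n) (≤-reflexive (sym eq))))))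

≤G-trans : ∀ {n} {K H G : Graph n} → K ≤G H → H ≤G G → K ≤G G
≤G-trans (K-graph , K⊆H , K≤H) (_ , H⊆G , H≤G) = K-graph , H⊆G ∘ K⊆H , λ i j → ≤-trans (K≤H i j) (H≤G i j)

sparse-subgraph : ∀ {n} {ℓ} {H G : Graph n} → H ≤G G → Sparse ℓ G → Sparse ℓ H
sparse-subgraph H≤G sparse K K≤H = sparse K (≤G-trans K≤H H≤G)

count-with-c : ∀ ℓ e v E w → ℓ + E ≤ 2 * w → e + 1 + 1 ≤ E → w ≤ suc v → ℓ + e ≤ 2 * v
count-with-c ℓ e v E w sparse gain w≤1+v = +-cancelʳ-≤ 2 (ℓ + e) (2 * v) (begin
  ℓ + e + 2      ≡⟨ +-assoc ℓ e 2 ⟩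
  ℓ + (e + 2)    ≡⟨ cong (ℓ +_) (+-assoc e 1 1) ⟨
  ℓ + (e + 1 + 1) ≤⟨ +-monoʳ-≤ ℓ gain ⟩
  ℓ + E          ≤⟨ sparse ⟩
  2 * w          ≤⟨ *-monoʳ-≤ 2 w≤1+v ⟩
  2 * suc v      ≡⟨ *-suc 2 v ⟩
  2 + 2 * v      ≡⟨ +-comm 2 (2 * v) ⟩
  2 * v + 2      ∎)
  where open ≤-Reasoning

count-without-c : ∀ ℓ e v E w → ¬ (ℓ + e ≤ 2 * v) → e + 1 + 0 ≤ E → w ≤ suc v → ℓ + E ≤ 2 * w → ℓ + E ≡ 2 * w
count-without-c ℓ e v E w violated gain w≤1+v sparse = ≤-antisym sparse (begin
  2 * w          ≤⟨ *-monoʳ-≤ 2 w≤1+v ⟩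
  2 * suc v      ≡⟨ *-suc 2 v ⟩
  suc (1 + 2 * v) ≡⟨ +-comm 1 (suc (2 * v)) ⟩
  suc (2 * v) + 1 ≤⟨ +-monoˡ-≤ 1 (≰⇒> violated) ⟩
  ℓ + e + 1      ≡⟨ +-assoc ℓ e 1 ⟩
  ℓ + (e + 1)    ≡⟨ cong (ℓ +_) (+-identityʳ (e + 1)) ⟨
  ℓ + (e + 1 + 0) ≤⟨ +-monoʳ-≤ ℓ gain ⟩
  ℓ + E          ∎)
  where open ≤-Reasoning

module Merge {n : ℕ} (a b : Fin n) where

  merge : Fin n → Fin n
  merge u with u F.≟ b
  ... | yes _ = a
  ... | no  _ = u

  push : (Fin n → Fin n → ℕ) → Fin n → Fin n → ℕ
  push h x y = sumFin (λ u → sumFin (λ w → [ merge u ≟ x ] * [ merge w ≟ y ] * h u w))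

  ind-merge : ∀ {x} → x ≢ b → ∀ u → [ merge u ≟ x ] ≡ [ u ≟ x ] + [ u ≟ b ] * [ x ≟ a ]
  ind-merge {x} x≢b u with u F.≟ b
  ... | yes refl = begin
    [ a ≟ x ]                  ≡⟨ ind-sym a x ⟩
    [ x ≟ a ]                  ≡⟨ +-identityʳ [ x ≟ a ] ⟨
    1 * [ x ≟ a ]              ≡⟨ cong (_+ 1 * [ x ≟ a ]) (ind-no (x≢b ∘ sym)) ⟨
    [ u ≟ x ] + 1 * [ x ≟ a ]  ∎
    where open ≡-Reasoning
  ... | no _ = sym (+-identityʳ [ u ≟ x ])

  sift-fibre : ∀ y (k : ℕ) (h : Fin n → ℕ) →
    sumFin (λ w → ([ w ≟ y ] + [ w ≟ b ] * k) * h w) ≡ h y + k * h b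
  sift-fibre y k h = begin
    sumFin (λ w → ([ w ≟ y ] + [ w ≟ b ] * k) * h w)
      ≡⟨ sumFin-cong distribute ⟩
    sumFin (λ w → [ w ≟ y ] * h w + k * ([ w ≟ b ] * h w))
      ≡⟨ sumFin-+ (λ w → [ w ≟ y ] * h w) (λ w → k * ([ w ≟ b ] * h w)) ⟩
    sumFin (λ w → [ w ≟ y ] * h w) + sumFin (λ w → k * ([ w ≟ b ] * h w))
      ≡⟨ cong₂ _+_ (sift y h) (trans (sumFin-*ˡ k (λ w → [ w ≟ b ] * h w)) (cong (k *_) (sift b h))) ⟩
    h y + k * h b
      ∎
    where
    open ≡-Reasoning
    distribute : ∀ w → ([ w ≟ y ] + [ w ≟ b ] * k) * h w ≡ [ w ≟ y ] * h w + k * ([ w ≟ b ] * h w)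
    distribute w = ring [ w ≟ y ] [ w ≟ b ] k (h w)
      where
      ring : ∀ p q k z → (p + q * k) * z ≡ p * z + k * (q * z)
      ring = solve-∀

  push-closed : ∀ h {x y} → x ≢ b → y ≢ b →
    push h x y ≡ h x y + [ y ≟ a ] * h x b + [ x ≟ a ] * (h b y + [ y ≟ a ] * h b b)
  push-closed h {x} {y} x≢b y≢b = begin
    push h x y
      ≡⟨ sumFin-cong (λ u → sumFin-cong (λ w →
           cong₂ (λ p q → p * q * h u w) (ind-merge x≢b u) (ind-merge y≢b w))) ⟩
    sumFin (λ u → sumFin (λ w → fibre x u * fibre y w * h u w))
      ≡⟨ sumFin-cong (λ u → sumFin-cong (λ w → *-assoc (fibre x u) (fibre y w) (h u w))) ⟩
    sumFin (λ u → sumFin (λ w → fibre x u * (fibre y w * h u w)))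
      ≡⟨ sumFin-cong (λ u → sumFin-*ˡ (fibre x u) (λ w → fibre y w * h u w)) ⟩
    sumFin (λ u → fibre x u * sumFin (λ w → fibre y w * h u w))
      ≡⟨ sumFin-cong (λ u → cong (fibre x u *_) (sift-fibre y [ y ≟ a ] (h u))) ⟩
    sumFin (λ u → fibre x u * (h u y + [ y ≟ a ] * h u b))
      ≡⟨ sift-fibre x [ x ≟ a ] (λ u → h u y + [ y ≟ a ] * h u b) ⟩
    h x y + [ y ≟ a ] * h x b + [ x ≟ a ] * (h b y + [ y ≟ a ] * h b b)
      ∎
    where
    open ≡-Reasoning
    fibre : Fin n → Fin n → ℕ
    fibre x u = [ u ≟ x ] + [ u ≟ b ] * [ x ≟ a ]

  push-away : ∀ h {x y} → x ≢ a → y ≢ a → x ≢ b → y ≢ b → push h x y ≡ h x y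
  push-away h {x} {y} x≢a y≢a x≢b y≢b rewrite push-closed h x≢b y≢b | ind-no x≢a | ind-no y≢a =
    trans (+-identityʳ _) (+-identityʳ (h x y))

  push-from-a : ∀ h {y} → a ≢ b → y ≢ a → y ≢ b → push h a y ≡ h a y + h b y
  push-from-a h {y} a≢b y≢a y≢b rewrite push-closed h a≢b y≢b | ind-no y≢a | ind-refl a =
    simplify (h a y) (h b y)
    where
    simplify : ∀ p q → p + 0 + 1 * (q + 0) ≡ p + q
    simplify = solve-∀

  push-loop-a : ∀ h → a ≢ b → push h a a ≡ h a a + h a b + (h b a + h b b)
  push-loop-a h a≢b rewrite push-closed h a≢b a≢b | ind-refl a = simplify (h a a) (h a b) (h b a) (h b b)
    where
    simplify : ∀ p q r s → p + 1 * q + 1 * (r + 1 * s) ≡ p + q + (r + s)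
    simplify = solve-∀

  push-sym : ∀ h → (∀ u w → h u w ≡ h w u) → ∀ x y → push h x y ≡ push h y x
  push-sym h sym-h x y = begin
    sumFin (λ u → sumFin (λ w → [ merge u ≟ x ] * [ merge w ≟ y ] * h u w))
      ≡⟨ sumFin-cong (λ u → sumFin-cong (λ w → transpose u w)) ⟩
    sumFin (λ u → sumFin (λ w → [ merge w ≟ y ] * [ merge u ≟ x ] * h w u))
      ≡⟨ sumFin-swap (λ u w → [ merge w ≟ y ] * [ merge u ≟ x ] * h w u) ⟩
    push h y x
      ∎
    where
    open ≡-Reasoning
    transpose : ∀ u w → [ merge u ≟ x ] * [ merge w ≟ y ] * h u w ≡ [ merge w ≟ y ] * [ merge u ≟ x ] * h w u
    transpose u w = cong₂ _*_ (*-comm [ merge u ≟ x ] [ merge w ≟ y ]) (sym-h u w)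

  push-total : ∀ h → Σ² (push h) ≡ Σ² h
  push-total h = begin
    sumFin (λ x → sumFin (λ y → sumFin (λ u → sumFin (λ w → A x y u w))))
      ≡⟨ sumFin-cong (λ x → sumFin-swap (λ y u → sumFin (λ w → A x y u w))) ⟩
    sumFin (λ x → sumFin (λ u → sumFin (λ y → sumFin (λ w → A x y u w))))
      ≡⟨ sumFin-swap (λ x u → sumFin (λ y → sumFin (λ w → A x y u w))) ⟩
    sumFin (λ u → sumFin (λ x → sumFin (λ y → sumFin (λ w → A x y u w))))
      ≡⟨ sumFin-cong (λ u → sumFin-cong (λ x → collapse-y u x)) ⟩
    sumFin (λ u → sumFin (λ x → sumFin (λ w → [ merge u ≟ x ] * h u w)))
      ≡⟨ sumFin-cong (λ u → trans (sumFin-swap (λ x w → [ merge u ≟ x ] * h u w))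
                                   (sumFin-cong (λ w → sift' (merge u) (λ _ → h u w)))) ⟩
    Σ² h
      ∎
    where
    open ≡-Reasoning
    A : Fin n → Fin n → Fin n → Fin n → ℕ
    A x y u w = [ merge u ≟ x ] * [ merge w ≟ y ] * h u w
    reorder : ∀ p q r → p * q * r ≡ q * (p * r)
    reorder = solve-∀
    collapse-y : ∀ u x → sumFin (λ y → sumFin (λ w → A x y u w)) ≡ sumFin (λ w → [ merge u ≟ x ] * h u w)
    collapse-y u x = trans (sumFin-swap (λ y w → A x y u w))
      (sumFin-cong (λ w → trans (sumFin-cong (λ y → reorder [ merge u ≟ x ] [ merge w ≟ y ] (h u w)))
                                (sift' (merge w) (λ _ → [ merge u ≟ x ] * h u w))))

module Triangle {n : ℕ} (G : Graph n) (a b c : Fin n)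
                (a≢b : a ≢ b) (b≢c : b ≢ c) (a≢c : a ≢ c) where

  g g₀ : Fin n → Fin n → ℕ
  g  = mult G
  g₀ = mult (delTri G a b c)

  triangle : Fin n → Fin n → ℕ
  triangle u w = edge a b u w + edge a c u w + edge b c u w

  delTri-spec : ∀ u w → (triangle u w ≡ 0 × g₀ u w ≡ g u w) ⊎ (triangle u w ≡ 1 × g₀ u w ≡ 0)
  delTri-spec u w with u F.≟ a | u F.≟ b | u F.≟ c | w F.≟ a | w F.≟ b | w F.≟ c
  ... | yes _ | no _  | no _  | yes _ | no _  | no _  = inj₁ (refl , refl)
  ... | yes _ | no _  | no _  | no _  | yes _ | no _  = inj₂ (refl , refl)
  ... | yes _ | no _  | no _  | no _  | no _  | yes _ = inj₂ (refl , refl)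
  ... | yes _ | no _  | no _  | no _  | no _  | no _  = inj₁ (refl , refl)
  ... | no _  | yes _ | no _  | yes _ | no _  | no _  = inj₂ (refl , refl)
  ... | no _  | yes _ | no _  | no _  | yes _ | no _  = inj₁ (refl , refl)
  ... | no _  | yes _ | no _  | no _  | no _  | yes _ = inj₂ (refl , refl)
  ... | no _  | yes _ | no _  | no _  | no _  | no _  = inj₁ (refl , refl)
  ... | no _  | no _  | yes _ | yes _ | no _  | no _  = inj₂ (refl , refl)
  ... | no _  | no _  | yes _ | no _  | yes _ | no _  = inj₂ (refl , refl)
  ... | no _  | no _  | yes _ | no _  | no _  | yes _ = inj₁ (refl , refl)
  ... | no _  | no _  | yes _ | no _  | no _  | no _  = inj₁ (refl , refl)
  ... | no _  | no _  | no _  | yes _ | no _  | no _  = inj₁ (refl , refl)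
  ... | no _  | no _  | no _  | no _  | yes _ | no _  = inj₁ (refl , refl)
  ... | no _  | no _  | no _  | no _  | no _  | yes _ = inj₁ (refl , refl)
  ... | no _  | no _  | no _  | no _  | no _  | no _  = inj₁ (refl , refl)
  ... | yes p | yes q | _     | _     | _     | _     = ⊥-elim (a≢b (trans (sym p) q))
  ... | _     | yes p | yes q | _     | _     | _     = ⊥-elim (b≢c (trans (sym p) q))
  ... | yes p | _     | yes q | _     | _     | _     = ⊥-elim (a≢c (trans (sym p) q))
  ... | _     | _     | _     | yes p | yes q | _     = ⊥-elim (a≢b (trans (sym p) q))
  ... | _     | _     | _     | _     | yes p | yes q = ⊥-elim (b≢c (trans (sym p) q))
  ... | _     | _     | _     | yes p | _     | yes q = ⊥-elim (a≢c (trans (sym p) q))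

  triangle-sym : ∀ u w → triangle u w ≡ triangle w u
  triangle-sym u w = cong₂ _+_ (cong₂ _+_ (edge-sym a b u w) (edge-sym a c u w)) (edge-sym b c u w)

  delTri≤ : ∀ u w → g₀ u w ≤ g u w
  delTri≤ u w with delTri-spec u w
  ... | inj₁ (_ , kept)    = ≤-reflexive kept
  ... | inj₂ (_ , removed) = ≤-trans (≤-reflexive removed) z≤n

  delTri-on-triangle : ∀ {u w : Fin n} → 1 ≤ triangle u w → g₀ u w ≡ 0
  delTri-on-triangle {u} {w} on with delTri-spec u w
  ... | inj₁ (t≡0 , _)      = ⊥-elim (1+n≰n (≤-trans on (≤-reflexive t≡0)))
  ... | inj₂ (_ , removed) = removed

  delTri-sym : (∀ i j → g i j ≡ g j i) → ∀ u w → g₀ u w ≡ g₀ w u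
  delTri-sym sym-g u w with delTri-spec u w | delTri-spec w u
  ... | inj₁ (_ , kept) | inj₁ (_ , kept') = trans kept (trans (sym-g u w) (sym kept'))
  ... | inj₂ (_ , gone) | inj₂ (_ , gone') = trans gone (sym gone')
  ... | inj₁ (t≡0 , _)  | inj₂ (t≡1 , _)   = ⊥-elim (0≢1+n (trans (sym t≡0) (trans (triangle-sym u w) t≡1)))
  ... | inj₂ (t≡1 , _)  | inj₁ (t≡0 , _)   = ⊥-elim (0≢1+n (trans (sym t≡0) (trans (triangle-sym w u) t≡1)))

  Edge⇒edge : ∀ {p q u w : Fin n} → Edge p q u w → 1 ≤ edge p q u w
  Edge⇒edge {p} {q} (inj₁ (refl , refl)) = edge-at p q
  Edge⇒edge {p} {q} (inj₂ (refl , refl)) = ≤-trans (edge-at p q) (≤-reflexive (edge-sym p q p q))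

  on-ab : ∀ {u w : Fin n} → Edge a b u w → 1 ≤ triangle u w
  on-ab {u} {w} e = ≤-trans (Edge⇒edge e)
    (≤-trans (m≤m+n (edge a b u w) (edge a c u w)) (m≤m+n (edge a b u w + edge a c u w) (edge b c u w)))

  on-ac : ∀ {u w : Fin n} → Edge a c u w → 1 ≤ triangle u w
  on-ac {u} {w} e = ≤-trans (Edge⇒edge e)
    (≤-trans (m≤n+m (edge a c u w) (edge a b u w)) (m≤m+n (edge a b u w + edge a c u w) (edge b c u w)))

  on-bc : ∀ {u w : Fin n} → Edge b c u w → 1 ≤ triangle u w
  on-bc {u} {w} e = ≤-trans (Edge⇒edge e) (m≤n+m (edge b c u w) (edge a b u w + edge a c u w))

  triangle-pos : ∀ {u w : Fin n} → 1 ≤ triangle u w → Edge a b u w ⊎ Edge a c u w ⊎ Edge b c u w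
  triangle-pos {u} {w} pos with positive-+ (edge a b u w + edge a c u w) (edge b c u w) pos
  ... | inj₂ bc = inj₂ (inj₂ (edge-pos bc))
  ... | inj₁ abc with positive-+ (edge a b u w) (edge a c u w) abc
  ...   | inj₁ ab = inj₁ (edge-pos ab)
  ...   | inj₂ ac = inj₂ (inj₁ (edge-pos ac))

  Edge-in-G : (∀ i j → g i j ≡ g j i) → ∀ {p q u w : Fin n} → Edge p q u w → 1 ≤ g p q → 1 ≤ g u w
  Edge-in-G sym-g         (inj₁ (refl , refl)) pq = pq
  Edge-in-G sym-g {p} {q} (inj₂ (refl , refl)) pq = ≤-trans pq (≤-reflexive (sym-g p q))

  triangle⊆G : (∀ i j → g i j ≡ g j i) → K3 G a b c → ∀ {u w : Fin n} → 1 ≤ triangle u w → 1 ≤ g u w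
  triangle⊆G sym-g (_ , _ , _ , ab , bc , ac) pos with triangle-pos pos
  ... | inj₁ e        = Edge-in-G sym-g e ab
  ... | inj₂ (inj₁ e) = Edge-in-G sym-g e ac
  ... | inj₂ (inj₂ e) = Edge-in-G sym-g e bc

  delTri+triangle≤ : (∀ i j → g i j ≡ g j i) → K3 G a b c → ∀ u w → g₀ u w + triangle u w ≤ g u w
  delTri+triangle≤ sym-g k3 u w with delTri-spec u w
  ... | inj₁ (t≡0 , kept)    = ≤-reflexive (trans (cong₂ _+_ kept t≡0) (+-identityʳ (g u w)))
  ... | inj₂ (t≡1 , removed) =
    ≤-trans (≤-reflexive (cong₂ _+_ removed t≡1)) (triangle⊆G sym-g k3 (≤-reflexive (sym t≡1)))

module Move {n : ℕ} (G : Graph n) (a b c : Fin n)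
            (a≢b : a ≢ b) (b≢c : b ≢ c) (a≢c : a ≢ c) where

  open Triangle G a b c a≢b b≢c a≢c public
  open Merge a b public

  g' : Fin n → Fin n → ℕ
  g' = mult (k3ToEdge G a b c)

  -- `k3ToEdge` uses its own (local) copy of `merge`; this states, for each
  -- summand, that the two copies agree.  Its type is inferred from the use.
  same-merge : ∀ (x y u w : Fin n) → _

  merged-mult : ∀ {x y} → x ≢ b → y ≢ b → g' x y ≡ push g₀ x y + edge c a x y
  merged-mult {x} {y} x≢b y≢b with x F.≟ b | y F.≟ b
  ... | yes x≡b | _       = ⊥-elim (x≢b x≡b)
  ... | no _    | yes y≡b = ⊥-elim (y≢b y≡b)
  ... | no _    | no _    =
    trans (cong (λ s → s + [ x ≟ c ] * [ y ≟ a ] + [ x ≟ a ] * [ y ≟ c ])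
                (sumFin-cong (λ u → sumFin-cong (λ w → same-merge x y u w))))
          (+-assoc (push g₀ x y) ([ x ≟ c ] * [ y ≟ a ]) ([ x ≟ a ] * [ y ≟ c ]))

  same-merge x y u w with u F.≟ b | w F.≟ b
  ... | yes _ | yes _ = refl
  ... | yes _ | no _  = refl
  ... | no _  | yes _ = refl
  ... | no _  | no _  = refl

  merged-from-b : ∀ y → g' b y ≡ 0
  merged-from-b y with b F.≟ b
  ... | yes _  = refl
  ... | no b≢b = ⊥-elim (b≢b refl)

  merged-to-b : ∀ x → g' x b ≡ 0
  merged-to-b x with x F.≟ b | b F.≟ b
  ... | yes _ | _      = refl
  ... | no _  | yes _  = refl
  ... | no _  | no b≢b = ⊥-elim (b≢b refl)

  new-edge-away : ∀ {x y} → x ≢ a → y ≢ a → edge c a x y ≡ 0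
  new-edge-away {x} {y} x≢a y≢a rewrite ind-no x≢a | ind-no y≢a =
    trans (+-identityʳ ([ x ≟ c ] * 0)) (*-zeroʳ [ x ≟ c ])

  new-edge-from-a : ∀ y → edge c a a y ≡ [ y ≟ c ]
  new-edge-from-a y rewrite ind-no a≢c | ind-refl a = +-identityʳ [ y ≟ c ]

  merged-away : ∀ {x y} → x ≢ a → y ≢ a → x ≢ b → y ≢ b → g' x y ≡ g₀ x y
  merged-away {x} {y} x≢a y≢a x≢b y≢b = begin
    g' x y                    ≡⟨ merged-mult x≢b y≢b ⟩
    push g₀ x y + edge c a x y ≡⟨ cong₂ _+_ (push-away g₀ x≢a y≢a x≢b y≢b) (new-edge-away x≢a y≢a) ⟩
    g₀ x y + 0                ≡⟨ +-identityʳ (g₀ x y) ⟩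
    g₀ x y                    ∎
    where open ≡-Reasoning

  merged-from-a : ∀ {y} → y ≢ a → y ≢ b → g' a y ≡ g₀ a y + g₀ b y + [ y ≟ c ]
  merged-from-a {y} y≢a y≢b = begin
    g' a y                      ≡⟨ merged-mult a≢b y≢b ⟩
    push g₀ a y + edge c a a y  ≡⟨ cong₂ _+_ (push-from-a g₀ a≢b y≢a y≢b) (new-edge-from-a y) ⟩
    g₀ a y + g₀ b y + [ y ≟ c ] ∎
    where open ≡-Reasoning

  merged-ac : g' a c ≡ 1
  merged-ac = begin
    g' a c                       ≡⟨ merged-from-a (a≢c ∘ sym) (b≢c ∘ sym) ⟩
    g₀ a c + g₀ b c + [ c ≟ c ]  ≡⟨ cong₂ _+_ (cong₂ _+_ g₀-ac g₀-bc) (ind-refl c) ⟩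
    1                            ∎
    where
    open ≡-Reasoning
    g₀-ac : g₀ a c ≡ 0
    g₀-ac = delTri-on-triangle {a} {c} (on-ac (inj₁ (refl , refl)))
    g₀-bc : g₀ b c ≡ 0
    g₀-bc = delTri-on-triangle {b} {c} (on-bc (inj₁ (refl , refl)))

  module Properties (G-graph : IsGraph G) where

    sym-g : ∀ i j → g i j ≡ g j i
    sym-g = IsGraph.sym G-graph

    sym-g₀ : ∀ i j → g₀ i j ≡ g₀ j i
    sym-g₀ = delTri-sym sym-g

    loop-g₀ : ∀ i → g₀ i i ≡ 0
    loop-g₀ i = n≤0⇒n≡0 (≤-trans (delTri≤ i i) (≤-reflexive (IsGraph.loopless G-graph i)))

    merged-sym : ∀ x y → g' x y ≡ g' y x
    merged-sym x y = by-cases (x F.≟ b) (y F.≟ b)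
      where
      by-cases : Dec (x ≡ b) → Dec (y ≡ b) → g' x y ≡ g' y x
      by-cases (yes refl) _          = trans (merged-from-b y) (sym (merged-to-b y))
      by-cases (no _)     (yes refl) = trans (merged-to-b x) (sym (merged-from-b x))
      by-cases (no x≢b)   (no y≢b)   = begin
        g' x y                      ≡⟨ merged-mult x≢b y≢b ⟩
        push g₀ x y + edge c a x y  ≡⟨ cong₂ _+_ (push-sym g₀ sym-g₀ x y) (edge-sym c a x y) ⟩
        push g₀ y x + edge c a y x  ≡⟨ merged-mult y≢b x≢b ⟨
        g' y x                      ∎
        where open ≡-Reasoning

    -- The merged graph is loopless: a loop at a would come from the
    -- deleted edge ab.
    merged-loopless : ∀ x → g' x x ≡ 0
    merged-loopless x = by-cases (x F.≟ b) (x F.≟ a)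
      where
      g₀-ab : g₀ a b ≡ 0
      g₀-ab = delTri-on-triangle {a} {b} (on-ab (inj₁ (refl , refl)))
      g₀-ba : g₀ b a ≡ 0
      g₀-ba = delTri-on-triangle {b} {a} (on-ab (inj₂ (refl , refl)))
      by-cases : Dec (x ≡ b) → Dec (x ≡ a) → g' x x ≡ 0
      by-cases (yes refl) _          = merged-from-b b
      by-cases (no _)     (yes refl) = begin
        g' a a                                           ≡⟨ merged-mult a≢b a≢b ⟩
        push g₀ a a + edge c a a a                       ≡⟨ cong₂ _+_ (push-loop-a g₀ a≢b) (new-edge-from-a a) ⟩
        g₀ a a + g₀ a b + (g₀ b a + g₀ b b) + [ a ≟ c ]
          ≡⟨ cong₂ _+_ (cong₂ _+_ (cong₂ _+_ (loop-g₀ a) g₀-ab) (cong₂ _+_ g₀-ba (loop-g₀ b))) (ind-no a≢c) ⟩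
        0                                                ∎
        where open ≡-Reasoning
      by-cases (no x≢b)   (no x≢a)   = trans (merged-away x≢a x≢a x≢b x≢b) (loop-g₀ x)

    at-most-one : ∀ {p q} → p ≤ 1 → q ≤ 1 → ¬ (1 ≤ p × 1 ≤ q) → p + q ≤ 1
    at-most-one z≤n         q≤1     _    = q≤1
    at-most-one (s≤s z≤n)   z≤n     _    = s≤s z≤n
    at-most-one (s≤s z≤n) (s≤s z≤n) both = ⊥-elim (both (s≤s z≤n , s≤s z≤n))

    -- The move creates a parallel edge at a only from a second triangle
    -- K₃(a,b,y) with y ≠ c.
    merged-simple : Simple G → K3 G a b c → ¬ (∃[ d ] (d ≢ c × K3 G a b d)) → Simple (k3ToEdge G a b c)
    merged-simple (_ , g≤1) (_ , _ , _ , ab∈G , _ , _) no-other-triangle = merged-loopless , g'≤1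
      where
      g₀≤1 : ∀ i j → g₀ i j ≤ 1
      g₀≤1 i j = ≤-trans (delTri≤ i j) (g≤1 i j)

      from-a≤1 : ∀ {y} → y ≢ a → y ≢ b → g' a y ≤ 1
      from-a≤1 {y} y≢a y≢b = by-cases (y F.≟ c)
        where
        other-triangle : ¬ (1 ≤ g₀ a y × 1 ≤ g₀ b y) → g₀ a y + g₀ b y ≤ 1
        other-triangle = at-most-one (g₀≤1 a y) (g₀≤1 b y)
        by-cases : Dec (y ≡ c) → g' a y ≤ 1
        by-cases (yes refl) = ≤-reflexive merged-ac
        by-cases (no y≢c) = begin
          g' a y                       ≡⟨ merged-from-a y≢a y≢b ⟩
          g₀ a y + g₀ b y + [ y ≟ c ]  ≡⟨ cong (g₀ a y + g₀ b y +_) (ind-no y≢c) ⟩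
          g₀ a y + g₀ b y + 0          ≡⟨ +-identityʳ (g₀ a y + g₀ b y) ⟩
          g₀ a y + g₀ b y              ≤⟨ other-triangle K₃aby ⟩
          1                            ∎
          where
          open ≤-Reasoning
          K₃aby : ¬ (1 ≤ g₀ a y × 1 ≤ g₀ b y)
          K₃aby (ay , by) = no-other-triangle (y , y≢c , a≢b , y≢b ∘ sym , y≢a ∘ sym , ab∈G ,
                                                ≤-trans by (delTri≤ b y) , ≤-trans ay (delTri≤ a y))

      g'≤1 : ∀ x y → g' x y ≤ 1
      g'≤1 x y = by-cases (x F.≟ b) (y F.≟ b) (x F.≟ a) (y F.≟ a)
        where
        by-cases : Dec (x ≡ b) → Dec (y ≡ b) → Dec (x ≡ a) → Dec (y ≡ a) → g' x y ≤ 1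
        by-cases (yes refl) _ _ _ = ≤-trans (≤-reflexive (merged-from-b y)) z≤n
        by-cases (no _) (yes refl) _ _ = ≤-trans (≤-reflexive (merged-to-b x)) z≤n
        by-cases (no _) (no _) (yes refl) (yes refl) = ≤-trans (≤-reflexive (merged-loopless a)) z≤n
        by-cases (no _) (no y≢b) (yes refl) (no y≢a) = from-a≤1 y≢a y≢b
        by-cases (no x≢b) (no _) (no x≢a) (yes refl) = ≤-trans (≤-reflexive (merged-sym x a)) (from-a≤1 x≢a x≢b)
        by-cases (no x≢b) (no y≢b) (no x≢a) (no y≢a) =
          ≤-trans (≤-reflexive (merged-away x≢a y≢a x≢b y≢b)) (g₀≤1 x y)

-- Undoing the merge for a subgraph H' of the merged graph that contains a.
-- The edges of H' at a are split between a and b (first as many as G₀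
-- has at a, the overflow at b), and the triangle edges are added back:
-- ab always, ac and bc with weight t.
module Unmerge {n : ℕ} (G : Graph n) (a b c : Fin n)
               (a≢b : a ≢ b) (b≢c : b ≢ c) (a≢c : a ≢ c)
               (G-graph : IsGraph G) (k3 : K3 G a b c)
               (H' : Graph n) (H'-graph : IsGraph H') (a∈H' : a ∈ V H')
               (H'⊆G-b : V H' ⊆ V G - b) (H'≤G' : ∀ i j → mult H' i j ≤ mult (k3ToEdge G a b c) i j)
               (t : ℕ) (t≤1 : t ≤ 1) (t⇒c∈H' : 1 ≤ t → c ∈ V H') (ac≤t : mult H' a c ≤ t) where

  open Move G a b c a≢b b≢c a≢c
  open Properties G-graph

  h' : Fin n → Fin n → ℕ
  h' = mult H'

  sym-h' : ∀ i j → h' i j ≡ h' j i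
  sym-h' = IsGraph.sym H'-graph

  loop-h' : ∀ i → h' i i ≡ 0
  loop-h' = IsGraph.loopless H'-graph

  H'-support : ∀ {i j} → 1 ≤ h' i j → i ∈ V H' × j ∈ V H'
  H'-support {i} {j} = IsGraph.support H'-graph i j

  b∉H' : b ∉ V H'
  b∉H' = ∉-of-⊆-removed H'⊆G-b

  h'-at-b : ∀ y → h' b y ≡ 0
  h'-at-b y = no-edges-outside H'-graph y b∉H'

  overflow : Fin n → ℕ
  overflow w = h' a w ∸ g₀ a w

  reassign : ∀ u w → Dec (u ≡ b) → Dec (w ≡ b) → ℕ
  reassign u w (yes _) (yes _) = 0
  reassign u w (yes _) (no _)  = overflow w
  reassign u w (no _)  (yes _) = overflow u
  reassign u w (no _)  (no _)  = h' u w

  requested : Fin n → Fin n → ℕ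
  requested u w = reassign u w (u F.≟ b) (w F.≟ b)

  unmerged : Fin n → Fin n → ℕ
  unmerged u w = requested u w ⊓ g₀ u w

  unmerged-away : ∀ {u w} → u ≢ b → w ≢ b → unmerged u w ≡ h' u w ⊓ g₀ u w
  unmerged-away {u} {w} u≢b w≢b = cong (_⊓ g₀ u w) (by-cases (u F.≟ b) (w F.≟ b))
    where
    by-cases : ∀ d e → reassign u w d e ≡ h' u w
    by-cases (yes u≡b) _         = ⊥-elim (u≢b u≡b)
    by-cases (no _)    (yes w≡b) = ⊥-elim (w≢b w≡b)
    by-cases (no _)    (no _)    = refl

  unmerged-from-b : ∀ {w} → w ≢ b → unmerged b w ≡ overflow w ⊓ g₀ b w
  unmerged-from-b {w} w≢b = cong (_⊓ g₀ b w) (by-cases (b F.≟ b) (w F.≟ b))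
    where
    by-cases : ∀ d e → reassign b w d e ≡ overflow w
    by-cases (no b≢b) _         = ⊥-elim (b≢b refl)
    by-cases (yes _)  (yes w≡b) = ⊥-elim (w≢b w≡b)
    by-cases (yes _)  (no _)    = refl

  unmerged-sym : ∀ u w → unmerged u w ≡ unmerged w u
  unmerged-sym u w = cong₂ _⊓_ (by-cases (u F.≟ b) (w F.≟ b)) (sym-g₀ u w)
    where
    by-cases : ∀ d e → reassign u w d e ≡ reassign w u e d
    by-cases (yes _) (yes _) = refl
    by-cases (yes _) (no _)  = refl
    by-cases (no _)  (yes _) = refl
    by-cases (no _)  (no _)  = sym-h' u w

  unmerged-support : ∀ {u w} → 1 ≤ unmerged u w → (u ≡ b ⊎ u ∈ V H') × (w ≡ b ⊎ w ∈ V H')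
  unmerged-support {u} {w} pos = by-cases (u F.≟ b) (w F.≟ b) (≤-trans pos (m⊓n≤m (requested u w) (g₀ u w)))
    where
    from-a : ∀ {v} → 1 ≤ overflow v → v ∈ V H'
    from-a {v} spilled = proj₂ (H'-support (≤-trans spilled (m∸n≤m (h' a v) (g₀ a v))))
    by-cases : ∀ d e → 1 ≤ reassign u w d e → (u ≡ b ⊎ u ∈ V H') × (w ≡ b ⊎ w ∈ V H')
    by-cases (yes _)   (yes _)   ()
    by-cases (yes u≡b) (no _)    pos = inj₁ u≡b , inj₂ (from-a pos)
    by-cases (no _)    (yes w≡b) pos = inj₂ (from-a pos) , inj₁ w≡b
    by-cases (no _)    (no _)    pos = inj₂ (proj₁ (H'-support pos)) , inj₂ (proj₂ (H'-support pos))

  restored : Fin n → Fin n → ℕ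
  restored u w = edge a b u w + t * (edge a c u w + edge b c u w)

  restored≤triangle : ∀ u w → restored u w ≤ triangle u w
  restored≤triangle u w = begin
    edge a b u w + t * (edge a c u w + edge b c u w)  ≤⟨ +-monoʳ-≤ (edge a b u w) (*-monoˡ-≤ _ t≤1) ⟩
    edge a b u w + 1 * (edge a c u w + edge b c u w)  ≡⟨ cong (edge a b u w +_) (*-identityˡ _) ⟩
    edge a b u w + (edge a c u w + edge b c u w)      ≡⟨ +-assoc (edge a b u w) _ _ ⟨
    triangle u w                                      ∎
    where open ≤-Reasoning

  restored-sym : ∀ u w → restored u w ≡ restored w u
  restored-sym u w = cong₂ _+_ (edge-sym a b u w) (cong (t *_) (cong₂ _+_ (edge-sym a c u w) (edge-sym b c u w)))

  restored-support : ∀ {u w} → 1 ≤ restored u w → Edge a b u w ⊎ (1 ≤ t × (Edge a c u w ⊎ Edge b c u w))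
  restored-support {u} {w} pos with positive-+ (edge a b u w) (t * (edge a c u w + edge b c u w)) pos
  ... | inj₁ ab = inj₁ (edge-pos ab)
  ... | inj₂ tacbc with positive-* t (edge a c u w + edge b c u w) tacbc
  ...   | t≥1 , acbc with positive-+ (edge a c u w) (edge b c u w) acbc
  ...     | inj₁ ac = inj₂ (t≥1 , inj₁ (edge-pos ac))
  ...     | inj₂ bc = inj₂ (t≥1 , inj₂ (edge-pos bc))

  Σ²-restored : Σ² restored ≡ 2 + t * 4
  Σ²-restored = begin
    Σ² restored
      ≡⟨ Σ²-+ (edge a b) (λ u w → t * side-edges u w) ⟩
    Σ² (edge a b) + Σ² (λ u w → t * side-edges u w)
      ≡⟨ cong (Σ² (edge a b) +_) (Σ²-*ˡ t side-edges) ⟩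
    Σ² (edge a b) + t * Σ² side-edges
      ≡⟨ cong (λ s → Σ² (edge a b) + t * s) (Σ²-+ (edge a c) (edge b c)) ⟩
    Σ² (edge a b) + t * (Σ² (edge a c) + Σ² (edge b c))
      ≡⟨ cong₂ (λ p q → p + t * q) (Σ²-edge a b) (cong₂ _+_ (Σ²-edge a c) (Σ²-edge b c)) ⟩
    2 + t * 4
      ∎
    where
    open ≡-Reasoning
    side-edges : Fin n → Fin n → ℕ
    side-edges u w = edge a c u w + edge b c u w

  lifted : Fin n → Fin n → ℕ
  lifted u w = unmerged u w + restored u w

  VH : Subset n
  VH = V H' ∪ ⁅ b ⁆

  H : Graph n
  H = graph VH lifted

  b∈VH : b ∈ VH
  b∈VH = x∈p∪q⁺ (inj₂ (x∈⁅x⁆ b))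

  H'⊆VH : ∀ {x} → x ∈ V H' → x ∈ VH
  H'⊆VH x∈H' = x∈p∪q⁺ (inj₁ x∈H')

  a∈VH : a ∈ VH
  a∈VH = H'⊆VH a∈H'

  c∈VH⇒c∈H' : c ∈ VH → c ∈ V H'
  c∈VH⇒c∈H' c∈VH with x∈p∪q⁻ (V H') ⁅ b ⁆ c∈VH
  ... | inj₁ c∈H' = c∈H'
  ... | inj₂ c∈b  = ⊥-elim (b≢c (sym (x∈⁅y⁆⇒x≡y b c∈b)))

  -- H is a subgraph of G: the unmerged edges lie in G₀ and the restored
  -- ones on the triangle.
  lifted≤g : ∀ u w → lifted u w ≤ g u w
  lifted≤g u w = ≤-trans (+-mono-≤ (m⊓n≤n (requested u w) (g₀ u w)) (restored≤triangle u w))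
                         (delTri+triangle≤ sym-g k3 u w)

  lifted-sym : ∀ u w → lifted u w ≡ lifted w u
  lifted-sym u w = cong₂ _+_ (unmerged-sym u w) (restored-sym u w)

  lifted-loopless : ∀ u → lifted u u ≡ 0
  lifted-loopless u = n≤0⇒n≡0 (≤-trans (lifted≤g u u) (≤-reflexive (IsGraph.loopless G-graph u)))

  Edge-in-VH : ∀ {p q u w} → Edge p q u w → p ∈ VH → q ∈ VH → u ∈ VH × w ∈ VH
  Edge-in-VH (inj₁ (refl , refl)) p∈ q∈ = p∈ , q∈
  Edge-in-VH (inj₂ (refl , refl)) p∈ q∈ = q∈ , p∈

  lifted-support : ∀ u w → 1 ≤ lifted u w → u ∈ VH × w ∈ VH
  lifted-support u w pos with positive-+ (unmerged u w) (restored u w) pos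
  ... | inj₁ moved = in-VH (proj₁ ends) , in-VH (proj₂ ends)
    where
    ends : (u ≡ b ⊎ u ∈ V H') × (w ≡ b ⊎ w ∈ V H')
    ends = unmerged-support moved
    in-VH : ∀ {x} → x ≡ b ⊎ x ∈ V H' → x ∈ VH
    in-VH (inj₁ refl) = b∈VH
    in-VH (inj₂ x∈H') = H'⊆VH x∈H'
  ... | inj₂ back with restored-support back
  ...   | inj₁ ab            = Edge-in-VH ab a∈VH b∈VH
  ...   | inj₂ (t≥1 , inj₁ ac) = Edge-in-VH ac a∈VH (H'⊆VH (t⇒c∈H' t≥1))
  ...   | inj₂ (t≥1 , inj₂ bc) = Edge-in-VH bc b∈VH (H'⊆VH (t⇒c∈H' t≥1))

  VH⊆VG : VH ⊆ V G
  VH⊆VG x∈VH with x∈p∪q⁻ (V H') ⁅ b ⁆ x∈VH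
  ... | inj₁ x∈H' = p─q⊆p (V G) ⁅ b ⁆ (H'⊆G-b x∈H')
  ... | inj₂ x∈b rewrite x∈⁅y⁆⇒x≡y b x∈b = proj₂ (IsGraph.support G-graph a b ab∈G)
    where
    ab∈G : 1 ≤ g a b
    ab∈G = proj₁ (proj₂ (proj₂ (proj₂ k3)))

  H≤G : H ≤G G
  H≤G = record { sym = lifted-sym ; loopless = lifted-loopless ; support = lifted-support } , VH⊆VG , lifted≤g

  ab∈H : 1 ≤ lifted a b
  ab∈H = ≤-trans (edge-at a b) (≤-trans (m≤m+n (edge a b a b) (t * (edge a c a b + edge b c a b)))
                                         (m≤n+m (restored a b) (unmerged a b)))

  ∣VH∣≤ : ∣ VH ∣ ≤ suc ∣ V H' ∣
  ∣VH∣≤ = ∣p∪⁅x⁆∣≤ (V H') b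

  -- Every edge of H' is accounted for by the push-forward of the
  -- unmerged edges, except the new edge ca, which has weight at most t.
  bound-from-a : ∀ {y} → y ≢ a → y ≢ b → h' a y ≤ unmerged a y + unmerged b y + t * [ y ≟ c ]
  bound-from-a {y} y≢a y≢b = by-cases (y F.≟ c)
    where
    by-cases : Dec (y ≡ c) → h' a y ≤ unmerged a y + unmerged b y + t * [ y ≟ c ]
    by-cases (yes refl) = begin
      h' a c                                       ≤⟨ ac≤t ⟩
      t                                            ≡⟨ trans (cong (t *_) (ind-refl c)) (*-identityʳ t) ⟨
      t * [ c ≟ c ]                                ≤⟨ m≤n+m (t * [ c ≟ c ]) (unmerged a c + unmerged b c) ⟩
      unmerged a c + unmerged b c + t * [ c ≟ c ]  ∎
      where open ≤-Reasoning
    by-cases (no y≢c) = begin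
      h' a y                                   ≤⟨ fill-two-bins (h' a y) (g₀ a y) (g₀ b y) fits ⟩
      h' a y ⊓ g₀ a y + overflow y ⊓ g₀ b y    ≡⟨ cong₂ _+_ (unmerged-away a≢b y≢b) (unmerged-from-b y≢b) ⟨
      unmerged a y + unmerged b y              ≤⟨ m≤m+n _ (t * [ y ≟ c ]) ⟩
      unmerged a y + unmerged b y + t * [ y ≟ c ] ∎
      where
      open ≤-Reasoning
      fits : h' a y ≤ g₀ a y + g₀ b y
      fits = begin
        h' a y                        ≤⟨ H'≤G' a y ⟩
        g' a y                        ≡⟨ merged-from-a y≢a y≢b ⟩
        g₀ a y + g₀ b y + [ y ≟ c ]   ≡⟨ cong (g₀ a y + g₀ b y +_) (ind-no y≢c) ⟩
        g₀ a y + g₀ b y + 0           ≡⟨ +-identityʳ (g₀ a y + g₀ b y) ⟩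
        g₀ a y + g₀ b y               ∎

  bound-at-a : ∀ y → y ≢ b → h' a y ≤ push unmerged a y + t * edge c a a y
  bound-at-a y y≢b = by-cases (y F.≟ a)
    where
    by-cases : Dec (y ≡ a) → h' a y ≤ push unmerged a y + t * edge c a a y
    by-cases (yes refl) = ≤-trans (≤-reflexive (loop-h' a)) z≤n
    by-cases (no y≢a)   = ≤-trans (bound-from-a y≢a y≢b) (≤-reflexive (sym
      (cong₂ _+_ (push-from-a unmerged a≢b y≢a y≢b) (cong (t *_) (new-edge-from-a y)))))

  -- The bound everywhere: b is isolated in H', the entries (x, a) follow by
  -- symmetry, and away from a and b nothing changes.
  bound : ∀ x y → h' x y ≤ push unmerged x y + t * edge c a x y
  bound x y = by-cases (x F.≟ b) (y F.≟ b) (x F.≟ a) (y F.≟ a)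
    where
    by-cases : Dec (x ≡ b) → Dec (y ≡ b) → Dec (x ≡ a) → Dec (y ≡ a) →
               h' x y ≤ push unmerged x y + t * edge c a x y
    by-cases (yes refl) _ _ _ = ≤-trans (≤-reflexive (h'-at-b y)) z≤n
    by-cases (no _) (yes refl) _ _ = ≤-trans (≤-reflexive (trans (sym-h' x b) (h'-at-b x))) z≤n
    by-cases (no _) (no y≢b) (yes refl) _ = bound-at-a y y≢b
    by-cases (no x≢b) (no _) (no _) (yes refl) = begin
      h' x a                                  ≡⟨ sym-h' x a ⟩
      h' a x                                  ≤⟨ bound-at-a x x≢b ⟩
      push unmerged a x + t * edge c a a x
        ≡⟨ cong₂ _+_ (push-sym unmerged unmerged-sym a x) (cong (t *_) (edge-sym c a a x)) ⟩
      push unmerged x a + t * edge c a x a    ∎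
      where open ≤-Reasoning
    by-cases (no x≢b) (no y≢b) (no x≢a) (no y≢a) = begin
      h' x y                                  ≡⟨ m≤n⇒m⊓n≡m fits ⟨
      h' x y ⊓ g₀ x y                         ≡⟨ unmerged-away x≢b y≢b ⟨
      unmerged x y                            ≡⟨ push-away unmerged x≢a y≢a x≢b y≢b ⟨
      push unmerged x y                       ≤⟨ m≤m+n _ (t * edge c a x y) ⟩
      push unmerged x y + t * edge c a x y    ∎
      where
      open ≤-Reasoning
      fits : h' x y ≤ g₀ x y
      fits = ≤-trans (H'≤G' x y) (≤-reflexive (merged-away x≢a y≢a x≢b y≢b))

  edge-gain : numEdges H' + 1 + t ≤ numEdges H
  edge-gain = halve (e' + 1 + t) E (+-cancelʳ-≤ (t * 2) _ _ (begin
    e' + 1 + t + (e' + 1 + t) + t * 2          ≡⟨ regroup e' t ⟩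
    e' + e' + (2 + t * 4)                      ≡⟨ cong (_+ (2 + t * 4)) (handshake H' sym-h' loop-h') ⟨
    Σ² h' + (2 + t * 4)                        ≤⟨ +-monoˡ-≤ (2 + t * 4) Σ²-bound ⟩
    Σ² unmerged + t * 2 + (2 + t * 4)          ≡⟨ swap-last (Σ² unmerged) (t * 2) (2 + t * 4) ⟩
    Σ² unmerged + (2 + t * 4) + t * 2          ≡⟨ cong (λ s → Σ² unmerged + s + t * 2) Σ²-restored ⟨
    Σ² unmerged + Σ² restored + t * 2          ≡⟨ cong (_+ t * 2) (Σ²-+ unmerged restored) ⟨
    Σ² lifted + t * 2                          ≡⟨ cong (_+ t * 2) (handshake H lifted-sym lifted-loopless) ⟩
    E + E + t * 2                              ∎))
    where
    open ≤-Reasoning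
    e' E : ℕ
    e' = numEdges H'
    E  = numEdges H
    regroup : ∀ e t → e + 1 + t + (e + 1 + t) + t * 2 ≡ e + e + (2 + t * 4)
    regroup = solve-∀
    swap-last : ∀ p q r → p + q + r ≡ p + r + q
    swap-last = solve-∀
    Σ²-bound : Σ² h' ≤ Σ² unmerged + t * 2
    Σ²-bound = begin
      Σ² h'                                                   ≤⟨ Σ²-mono bound ⟩
      Σ² (λ x y → push unmerged x y + t * edge c a x y)       ≡⟨ Σ²-+ (push unmerged) (λ x y → t * edge c a x y) ⟩
      Σ² (push unmerged) + Σ² (λ x y → t * edge c a x y)
        ≡⟨ cong₂ _+_ (push-total unmerged) (Σ²-*ˡ t (edge c a)) ⟩
      Σ² unmerged + t * Σ² (edge c a)                         ≡⟨ cong (λ s → Σ² unmerged + t * s) (Σ²-edge c a) ⟩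
      Σ² unmerged + t * 2                                     ∎

  lift-sparse : ∀ ℓ → Sparse ℓ G → ℓ + numEdges H ≤ 2 * ∣ VH ∣
  lift-sparse ℓ sparse = ≤-minus⇒ ℓ (2 * ∣ VH ∣) (numEdges H) (sparse H H≤G (≤-trans one≤ edge-gain))
    where
    one≤ : 1 ≤ numEdges H' + 1 + t
    one≤ = ≤-trans (m≤n+m 1 (numEdges H')) (m≤m+n (numEdges H' + 1) t)

module Sparsity {n : ℕ} (G : Graph n) (a b c : Fin n)
                (a≢b : a ≢ b) (b≢c : b ≢ c) (a≢c : a ≢ c)
                (G-graph : IsGraph G) (k3 : K3 G a b c) where

  open Move G a b c a≢b b≢c a≢c
  open Properties G-graph

  avoiding-a : ∀ (H' : Graph n) → IsGraph H' → V H' ⊆ V G - b → (∀ i j → mult H' i j ≤ g' i j) →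
               a ∉ V H' → H' ≤G G
  avoiding-a H' H'-graph H'⊆G-b H'≤G' a∉H' = H'-graph , p─q⊆p (V G) ⁅ b ⁆ ∘ H'⊆G-b , H'≤G
    where
    away : ∀ {x} → x ∈ V H' → x ≢ a × x ≢ b
    away x∈H' = (λ { refl → a∉H' x∈H' }) , (λ { refl → ∉-of-⊆-removed H'⊆G-b x∈H' })
    H'≤G : ∀ x y → mult H' x y ≤ g x y
    H'≤G x y with x ∈? V H' | y ∈? V H'
    ... | no x∉H' | _ = ≤-trans (≤-reflexive (no-edges-outside H'-graph y x∉H')) z≤n
    ... | yes _ | no y∉H' =
      ≤-trans (≤-reflexive (trans (IsGraph.sym H'-graph x y) (no-edges-outside H'-graph x y∉H'))) z≤n
    ... | yes x∈H' | yes y∈H' with away x∈H' | away y∈H'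
    ...   | x≢a , x≢b | y≢a , y≢b =
      ≤-trans (H'≤G' x y) (≤-trans (≤-reflexive (merged-away x≢a y≢a x≢b y≢b)) (delTri≤ x y))

  merged-sparse : ∀ ℓ → Sparse ℓ G → ¬ (∃[ Y ] (Y ≤G G × Tight ℓ Y × 1 ≤ mult Y a b × c ∉ V Y)) →
                  Sparse ℓ (k3ToEdge G a b c)
  merged-sparse ℓ sparse no-Y H' (H'-graph , H'⊆G-b , H'≤G') e'≥1 with a ∈? V H' | c ∈? V H'
  ... | no a∉H'  | _        = sparse H' (avoiding-a H' H'-graph H'⊆G-b H'≤G' a∉H') e'≥1
  -- With c ∈ H', the lift has one more vertex and two more edges.
  ... | yes a∈H' | yes c∈H' =
    ⇒≤-minus ℓ (2 * ∣ V H' ∣) (numEdges H')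
      (count-with-c ℓ (numEdges H') (∣ V H' ∣) (numEdges H) (∣ VH ∣) (lift-sparse ℓ sparse) edge-gain ∣VH∣≤)
    where
    ac≤1 : mult H' a c ≤ 1
    ac≤1 = ≤-trans (H'≤G' a c) (≤-reflexive merged-ac)
    open Unmerge G a b c a≢b b≢c a≢c G-graph k3 H' H'-graph a∈H' H'⊆G-b H'≤G' 1 ≤-refl (λ _ → c∈H') ac≤1
  -- With c ∉ H', the lift has one more vertex and one more edge, so if
  -- H' violates the count then the lift is tight, contains ab, avoids c.
  ... | yes a∈H' | no c∉H' with ℓ + numEdges H' ≤? 2 * ∣ V H' ∣
  ...   | yes counted = ⇒≤-minus ℓ (2 * ∣ V H' ∣) (numEdges H') counted
  ...   | no violated = ⊥-elim (no-Y (H , H≤G , H-tight , ab∈H , c∉H' ∘ c∈VH⇒c∈H'))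
    where
    ac≤0 : mult H' a c ≤ 0
    ac≤0 = ≤-reflexive (trans (IsGraph.sym H'-graph a c) (no-edges-outside H'-graph a c∉H'))
    open Unmerge G a b c a≢b b≢c a≢c G-graph k3 H' H'-graph a∈H' H'⊆G-b H'≤G' 0 z≤n (λ ()) ac≤0
    H-tight : Tight ℓ H
    H-tight = sparse-subgraph H≤G sparse , ≡-minus ℓ (2 * ∣ VH ∣) (numEdges H)
      (count-without-c ℓ (numEdges H') (∣ V H' ∣) (numEdges H) (∣ VH ∣) violated edge-gain ∣VH∣≤ (lift-sparse ℓ sparse))

-- Lemma 3.4: both parts follow from the move's properties; only the
-- sparsity half of tightness is needed.
lemma3p4 : {n : ℕ} (ℓ : ℕ) → 1 ≤ ℓ → ℓ ≤ 3 → (G : Graph n) → IsGraph G → Simple G → Tight ℓ G → (a b c : Fin n) → K3 G a b c → ((¬ (∃[ d ] (d ≢ c × K3 G a b d))) → Simple (k3ToEdge G a b c)) × ((¬ (∃[ Y ] (Y ≤G G × Tight ℓ Y × 1 ≤ mult Y a b × c ∉ V Y))) → Sparse ℓ (k3ToEdge G a b c))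
lemma3p4 ℓ _ _ G G-graph G-simple (G-sparse , _) a b c k3@(a≢b , b≢c , a≢c , _) =
  merged-simple G-simple k3 , merged-sparse ℓ G-sparse
  where
  open Move.Properties G a b c a≢b b≢c a≢c G-graph using (merged-simple)
  open Sparsity G a b c a≢b b≢c a≢c G-graph k3 using (merged-sparse)
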